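{- Let $c \ge 1$ be an integer. For $n \ge 0$ let $a(n)$ be the number of $n$-color compositions of $n$ in which every part has a color in $\{1, 2, \ldots, c\}$, and set $a(n)=0$ for $n<0$. Then $a(0) = a(1) = 1$ and for all $n \ge 2$, \[ a(n) = 2a(n-1) + a(n-2) + \cdots + a(n-c). \] Moreover, if $c \ge 2$, then for every $n \ge 1$, \[ a(n) = \sum_{i_c=1}^{n} \sum_{\ell=0}^{n-i_c} \binom{\ell+i_c-1}{i_c-1} G_c(n-i_c-\ell,\, i_c), \] where the functions $G_j$ ($2 \le j \le c$) are defined on integers by $G_2(x, y) = \binom{y}{x}$ and, for $3 \le j \le c$, \[ G_j(x, y) = \sum_{k=0}^{y} \binom{y}{y-k} G_{j-1}\bigl(x - (j-1)(y-k),\, k\bigr), \] with the convention $\binom{y}{x} = 0$ if $x<0$ or $x>y$.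
   Context: An $n$-color composition of a positive integer $n$ is a finite sequence of parts $(\kappa^{(1)}_{c_1}, \ldots, \kappa^{(r)}_{c_r})$, where $\kappa^{(1)}, \ldots, \kappa^{(r)}$ are positive integers with sum $n$ and each part $\kappa^{(j)}$ carries a color $c_j \in \{1, \ldots, \kappa^{(j)}\}$. By convention there is exactly one (empty) composition of $0$. -}

module Defs where

open import Data.Nat using (ℕ; zero; suc; _+_; _*_; _∸_; _≤_; _≤ᵇ_)
open import Data.Nat.Combinatorics using (_C_)
open import Data.Integer using (ℤ; +_; -[1+_]) renaming (_-_ to _-ℤ_; _*_ to _*ℤ_)
open import Data.List using (List; []; _∷_; map; applyUpTo)
open import Data.Nat.ListAction using (sum)
open import Data.Bool using (true; false)
open import Data.Product using (Σ; _×_; proj₁)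
open import Relation.Binary.PropositionalEquality using (_≡_)

-- A colored part κ_col with colors restricted to {1,…,c}:
-- a size κ ≥ 1 (implied by 1 ≤ col ≤ κ) and a color col with 1 ≤ col ≤ κ and col ≤ c.
Part : ℕ → Set
Part c = Σ ℕ λ κ → Σ ℕ λ col → (1 ≤ col) × (col ≤ κ) × (col ≤ c)

size : ∀ {c} → Part c → ℕ
size = proj₁

NCComp : ℕ → ℕ → Set
NCComp c n = Σ (List (Part c)) λ ps → sum (map size ps) ≡ n

-- Σ_{i = lo}^{hi} f i  (empty if hi < lo)
∑[_⋯_] : ℕ → ℕ → (ℕ → ℕ) → ℕ
∑[ lo ⋯ hi ] f = sum (applyUpTo (λ i → f (lo + i)) (suc hi ∸ lo))

-- a(n - j), with the convention a(m) = 0 for m < 0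
shiftedA : (ℕ → ℕ) → ℕ → ℕ → ℕ
shiftedA a n j with j ≤ᵇ n
... | true  = a (n ∸ j)
... | false = 0

-- binomial coefficient (y choose x) for integer x; 0 if x < 0 or x > y
binomℤ : ℕ → ℤ → ℕ
binomℤ y (+ x)    = y C x
binomℤ y -[1+ _ ] = 0

-- Gaux m = G_{m+2}
Gaux : ℕ → ℤ → ℕ → ℕ
Gaux zero    x y = binomℤ y x
Gaux (suc m) x y =
  ∑[ 0 ⋯ y ] (λ k → (y C (y ∸ k)) * Gaux m (x -ℤ (+ (suc (suc m)) *ℤ + (y ∸ k))) k)
  -- here j = m + 3, so j - 1 = m + 2

G : ℕ → ℤ → ℕ → ℕ
G j = Gaux (j ∸ 2)

-- A composition of n + 1 is a first part of some size k + 1, coloured in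
-- colours c k = min (k + 1, c) ways, followed by a composition of n - k. In the
-- commutative semiring of power series ℕ → ℕ under the Cauchy product, a is
-- therefore the coefficient sequence of Σᵢ (X W)ⁱ with W = Σₖ colours c k Xᵏ, and
-- a (n + 1) is the coefficient of Xⁿ in W a. The recurrence follows from
-- colours c (k + 1) = colours c k + [k + 1 < c]. For the closed formula,
-- W = (1 - X)⁻¹ (1 + X + ⋯ + X^(c - 1)), so the coefficients of (X W)ⁱ are
-- convolutions of binom (ℓ + i - 1) (i - 1), the coefficients of (1 - X)⁻ⁱ, with
-- those of (1 + ⋯ + X^(c - 1))ⁱ; the binomial theorem applied to
-- (1 + ⋯ + X^(c - 2)) + X^(c - 1) shows that the latter obey the recursion defining G c.

module Submission where

open import Algebra.Bundles using (CommutativeSemiring)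
import Algebra.Construct.Pointwise as Pointwise
import Algebra.Definitions.RawSemiring
open import Algebra.Structures.Biased using (isCommutativeMonoidˡ; isCommutativeSemiringˡ)
open import Data.Bool using (true; false)
open import Data.Fin using (Fin; toℕ; fromℕ<)
open import Data.Fin.Permutation using (↔⇒≡)
open import Data.Fin.Properties using (toℕ<n; fromℕ<-toℕ; toℕ-fromℕ<; +↔⊎; *↔×; 1↔⊤)
open import Data.List using (List; []; _∷_; map; applyUpTo)
open import Data.Nat hiding (_^_)
open import Data.Nat.Combinatorics using (_C_; nCn≡1; nCk+nC[k+1]≡[n+1]C[k+1]; nCk≡nC[n∸k])
open import Data.Nat.Induction using (<-rec)
open import Data.Nat.ListAction using (sum)
open import Data.Nat.Properties
open import Algebra.Properties.CommutativeSemigroup +-commutativeSemigroup using (interchange)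
open import Data.Product using (Σ; Σ-syntax; ∃-syntax; _×_; _,_; proj₁)
open import Data.Product.Function.NonDependent.Propositional using (_×-↔_)
open import Data.Sum using (_⊎_; inj₁; inj₂)
open import Data.Sum.Function.Propositional using (_⊎-↔_)
open import Data.Unit using (⊤; tt)
open import Function.Base using (_∘_)
open import Function.Bundles using (_↔_; mk↔ₛ′)
open import Function.Properties.Inverse using (↔-sym; ↔-trans; ↔-refl)
open import Level using (0ℓ)
open import Relation.Binary.PropositionalEquality
open import Relation.Nullary using (yes; no; contradiction)
open ≡-Reasoning

open import Defs

-- Σ< n f = f 0 + ⋯ + f (n - 1). The sums ∑[ lo ⋯ hi ] of Defs unfold to it
-- definitionally, e.g. ∑[ 1 ⋯ n ] f to Σ< n (f ∘ suc).
Σ< : ℕ → (ℕ → ℕ) → ℕ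
Σ< n f = sum (applyUpTo f n)

Σ<-cong : ∀ n {f g : ℕ → ℕ} → (∀ i → i < n → f i ≡ g i) → Σ< n f ≡ Σ< n g
Σ<-cong zero    f≡g = refl
Σ<-cong (suc n) f≡g = cong₂ _+_ (f≡g 0 z<s) (Σ<-cong n (λ i i<n → f≡g (suc i) (s<s i<n)))

Σ<-zero : ∀ n {f : ℕ → ℕ} → (∀ i → i < n → f i ≡ 0) → Σ< n f ≡ 0
Σ<-zero zero    f≡0 = refl
Σ<-zero (suc n) f≡0 = cong₂ _+_ (f≡0 0 z<s) (Σ<-zero n (λ i i<n → f≡0 (suc i) (s<s i<n)))

Σ<-extend : ∀ n d {f : ℕ → ℕ} → (∀ i → n ≤ i → f i ≡ 0) → Σ< (n + d) f ≡ Σ< n f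
Σ<-extend zero    d f≡0 = Σ<-zero d (λ i _ → f≡0 i z≤n)
Σ<-extend (suc n) d f≡0 = cong (_ +_) (Σ<-extend n d (λ i n≤i → f≡0 (suc i) (s≤s n≤i)))

shiftedA-≤ : ∀ a {n j} → j ≤ n → shiftedA a n j ≡ a (n ∸ j)
shiftedA-≤ a {n} {j} j≤n with j ≤ᵇ n | ≤⇒≤ᵇ j≤n
... | true | _ = refl

shiftedA-> : ∀ a {n j} → n < j → shiftedA a n j ≡ 0
shiftedA-> a {n} {j} n<j with j ≤ᵇ n | ≤ᵇ⇒≤ j n
... | false | _   = refl
... | true  | j≤n = contradiction (j≤n _) (<⇒≱ n<j)

shiftedA-suc : ∀ a n j → shiftedA a (suc n) (suc j) ≡ shiftedA a n j
shiftedA-suc a n j with j ≤? n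
... | yes j≤n = trans (shiftedA-≤ a (s≤s j≤n)) (sym (shiftedA-≤ a j≤n))
... | no  j≰n = trans (shiftedA-> a (s≤s (≰⇒> j≰n))) (sym (shiftedA-> a (≰⇒> j≰n)))

shiftedA-cong : ∀ {a b} → a ≗ b → ∀ n j → shiftedA a n j ≡ shiftedA b n j
shiftedA-cong {a} {b} a≗b n j with j ≤ᵇ n
... | true  = a≗b (n ∸ j)
... | false = refl

Series : Set
Series = ℕ → ℕ

infixl 6 _⊕_
infixl 7 _⊛_

_⊕_ : Series → Series → Series
(f ⊕ g) n = f n + g n

-- ones c = 1 + X + ⋯ + X^(c - 1)
ones : ℕ → Series
ones zero    _       = 0
ones (suc c) zero    = 1
ones (suc c) (suc k) = ones c k

𝟘 𝟙 X : Series
𝟘 _       = 0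
𝟙         = ones 1
X zero    = 0
X (suc n) = 𝟙 n

_⊛_ : Series → Series → Series
(f ⊛ g) zero    = f 0 * g 0
(f ⊛ g) (suc n) = f 0 * g (suc n) + (f ∘ suc ⊛ g) n

⊛-coeff : ∀ f g n → (f ⊛ g) n ≡ Σ< (suc n) (λ k → f k * g (n ∸ k))
⊛-coeff f g zero    = sym (+-identityʳ _)
⊛-coeff f g (suc n) = cong (f 0 * g (suc n) +_) (⊛-coeff (f ∘ suc) g n)

⊛-cong-≤ : ∀ n {f f′ g g′ : Series} → (∀ k → k ≤ n → f k ≡ f′ k) → (∀ k → k ≤ n → g k ≡ g′ k) →
           (f ⊛ g) n ≡ (f′ ⊛ g′) n
⊛-cong-≤ n {f} {f′} {g} {g′} f≡f′ g≡g′ = begin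
  (f ⊛ g) n                                ≡⟨ ⊛-coeff f g n ⟩
  Σ< (suc n) (λ k → f k * g (n ∸ k))       ≡⟨ Σ<-cong (suc n) term ⟩
  Σ< (suc n) (λ k → f′ k * g′ (n ∸ k))     ≡⟨ ⊛-coeff f′ g′ n ⟨
  (f′ ⊛ g′) n                              ∎
  where
  term : ∀ k → k < suc n → f k * g (n ∸ k) ≡ f′ k * g′ (n ∸ k)
  term k k<1+n = cong₂ _*_ (f≡f′ k (s≤s⁻¹ k<1+n)) (g≡g′ (n ∸ k) (m∸n≤m n k))

⊛-cong : ∀ {f f′ g g′} → f ≗ f′ → g ≗ g′ → f ⊛ g ≗ f′ ⊛ g′
⊛-cong f≗f′ g≗g′ n = ⊛-cong-≤ n (λ k _ → f≗f′ k) (λ k _ → g≗g′ k)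

⊛-zeroˡ : ∀ f → 𝟘 ⊛ f ≗ 𝟘
⊛-zeroˡ f zero    = refl
⊛-zeroˡ f (suc n) = ⊛-zeroˡ f n

⊛-identityˡ : ∀ f → 𝟙 ⊛ f ≗ f
⊛-identityˡ f zero    = +-identityʳ (f 0)
⊛-identityˡ f (suc n) = trans (cong₂ _+_ (+-identityʳ (f (suc n))) (⊛-zeroˡ f n)) (+-identityʳ (f (suc n)))

⊛-distribʳ-⊕ : ∀ f g h → (g ⊕ h) ⊛ f ≗ g ⊛ f ⊕ h ⊛ f
⊛-distribʳ-⊕ f g h zero    = *-distribʳ-+ (f 0) (g 0) (h 0)
⊛-distribʳ-⊕ f g h (suc n) = begin
  (g 0 + h 0) * f (suc n) + ((g ∘ suc ⊕ h ∘ suc) ⊛ f) n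
    ≡⟨ cong₂ _+_ (*-distribʳ-+ (f (suc n)) (g 0) (h 0)) (⊛-distribʳ-⊕ f (g ∘ suc) (h ∘ suc) n) ⟩
  (g 0 * f (suc n) + h 0 * f (suc n)) + ((g ∘ suc ⊛ f) n + (h ∘ suc ⊛ f) n)
    ≡⟨ interchange (g 0 * f (suc n)) (h 0 * f (suc n)) _ _ ⟩
  (g ⊛ f ⊕ h ⊛ f) (suc n) ∎

⊛-scaleˡ : ∀ a f g → (λ k → a * f k) ⊛ g ≗ (λ n → a * (f ⊛ g) n)
⊛-scaleˡ a f g zero    = *-assoc a (f 0) (g 0)
⊛-scaleˡ a f g (suc n) = begin
  a * f 0 * g (suc n) + ((λ k → a * f (suc k)) ⊛ g) n
    ≡⟨ cong₂ _+_ (*-assoc a (f 0) (g (suc n))) (⊛-scaleˡ a (f ∘ suc) g n) ⟩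
  a * (f 0 * g (suc n)) + a * (f ∘ suc ⊛ g) n
    ≡⟨ *-distribˡ-+ a _ _ ⟨
  a * (f ⊛ g) (suc n) ∎

⊛-assoc : ∀ f g h → (f ⊛ g) ⊛ h ≗ f ⊛ (g ⊛ h)
⊛-assoc f g h zero    = *-assoc (f 0) (g 0) (h 0)
⊛-assoc f g h (suc n) = begin
  f 0 * g 0 * h (suc n) + (((λ k → f 0 * g (suc k)) ⊕ f ∘ suc ⊛ g) ⊛ h) n
    ≡⟨ cong (f 0 * g 0 * h (suc n) +_) (⊛-distribʳ-⊕ h (λ k → f 0 * g (suc k)) (f ∘ suc ⊛ g) n) ⟩
  f 0 * g 0 * h (suc n) + (((λ k → f 0 * g (suc k)) ⊛ h) n + ((f ∘ suc ⊛ g) ⊛ h) n)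
    ≡⟨ cong₂ (λ x y → f 0 * g 0 * h (suc n) + (x + y)) (⊛-scaleˡ (f 0) (g ∘ suc) h n) (⊛-assoc (f ∘ suc) g h n) ⟩
  f 0 * g 0 * h (suc n) + (f 0 * (g ∘ suc ⊛ h) n + (f ∘ suc ⊛ (g ⊛ h)) n)
    ≡⟨ +-assoc (f 0 * g 0 * h (suc n)) _ _ ⟨
  f 0 * g 0 * h (suc n) + f 0 * (g ∘ suc ⊛ h) n + (f ∘ suc ⊛ (g ⊛ h)) n
    ≡⟨ cong (_+ (f ∘ suc ⊛ (g ⊛ h)) n) (trans (cong (_+ f 0 * (g ∘ suc ⊛ h) n) (*-assoc (f 0) (g 0) _))
                                              (sym (*-distribˡ-+ (f 0) (g 0 * h (suc n)) _))) ⟩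
  f 0 * (g ⊛ h) (suc n) + (f ∘ suc ⊛ (g ⊛ h)) n ∎

⊛-unfoldʳ : ∀ f g n → (f ⊛ g) (suc n) ≡ (f ⊛ g ∘ suc) n + f (suc n) * g 0
⊛-unfoldʳ f g zero    = refl
⊛-unfoldʳ f g (suc n) = begin
  f 0 * g (suc (suc n)) + (f ∘ suc ⊛ g) (suc n)
    ≡⟨ cong (f 0 * g (suc (suc n)) +_) (⊛-unfoldʳ (f ∘ suc) g n) ⟩
  f 0 * g (suc (suc n)) + ((f ∘ suc ⊛ g ∘ suc) n + f (suc (suc n)) * g 0)
    ≡⟨ +-assoc (f 0 * g (suc (suc n))) _ _ ⟨
  (f ⊛ g ∘ suc) (suc n) + f (suc (suc n)) * g 0 ∎

⊛-comm : ∀ f g → f ⊛ g ≗ g ⊛ f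
⊛-comm f g zero    = *-comm (f 0) (g 0)
⊛-comm f g (suc n) = begin
  f 0 * g (suc n) + (f ∘ suc ⊛ g) n ≡⟨ cong₂ _+_ (*-comm (f 0) _) (⊛-comm (f ∘ suc) g n) ⟩
  g (suc n) * f 0 + (g ⊛ f ∘ suc) n ≡⟨ +-comm (g (suc n) * f 0) _ ⟩
  (g ⊛ f ∘ suc) n + g (suc n) * f 0 ≡⟨ ⊛-unfoldʳ g f n ⟨
  (g ⊛ f) (suc n)                   ∎

seriesSemiring : CommutativeSemiring 0ℓ 0ℓ
seriesSemiring = record
  { isCommutativeSemiring = isCommutativeSemiringˡ record
    { +-isCommutativeMonoid = Pointwise.isCommutativeMonoid ℕ +-0-isCommutativeMonoid
    ; *-isCommutativeMonoid = isCommutativeMonoidˡ record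
      { isSemigroup = record
        { isMagma = record { isEquivalence = Pointwise.isEquivalence ℕ isEquivalence ; ∙-cong = ⊛-cong }
        ; assoc = ⊛-assoc
        }
      ; identityˡ = ⊛-identityˡ
      ; comm = ⊛-comm
      }
    ; distribʳ = ⊛-distribʳ-⊕
    ; zeroˡ = ⊛-zeroˡ
    }
  }

open CommutativeSemiring seriesSemiring using (rawSemiring)
  renaming (distribˡ to ⊛-distribˡ-⊕; zeroʳ to ⊛-zeroʳ; *-identityʳ to ⊛-identityʳ)
module SeriesOps = Algebra.Definitions.RawSemiring rawSemiring
open SeriesOps using (_^_)
open import Algebra.Properties.CommutativeSemiring.Binomial seriesSemiring using (binomialExpansion)
  renaming (theorem to binomial-theorem)
open import Algebra.Properties.CommutativeSemiring.Exp seriesSemiring using (^-distrib-*)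
open import Algebra.Properties.Semiring.Exp (CommutativeSemiring.semiring seriesSemiring) using (^-congˡ; ^-assocʳ)

X⊛-suc : ∀ f n → (X ⊛ f) (suc n) ≡ f n
X⊛-suc f n = ⊛-identityˡ f n

X^-⊛ : ∀ d f n → (X ^ d ⊛ f) n ≡ shiftedA f n d
X^-⊛ zero    f n       = ⊛-identityˡ f n
X^-⊛ (suc d) f zero    = sym (shiftedA-> f {j = suc d} z<s)
X^-⊛ (suc d) f (suc n) = begin
  (X ⊛ X ^ d ⊛ f) (suc n)    ≡⟨ ⊛-assoc X (X ^ d) f (suc n) ⟩
  (X ⊛ (X ^ d ⊛ f)) (suc n)  ≡⟨ X⊛-suc (X ^ d ⊛ f) n ⟩
  (X ^ d ⊛ f) n              ≡⟨ X^-⊛ d f n ⟩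
  shiftedA f n d             ≡⟨ shiftedA-suc f n d ⟨
  shiftedA f (suc n) (suc d) ∎

⊛-Σ< : ∀ N f (g : ℕ → Series) n → (f ⊛ (λ k → Σ< N (λ i → g i k))) n ≡ Σ< N (λ i → (f ⊛ g i) n)
⊛-Σ< zero    f g n = ⊛-zeroʳ f n
⊛-Σ< (suc N) f g n = trans (⊛-distribˡ-⊕ f (g 0) _ n) (cong ((f ⊛ g 0) n +_) (⊛-Σ< N f (g ∘ suc) n))

ones-⊛ : ∀ c f n → (ones c ⊛ f) n ≡ Σ< c (shiftedA f n)
ones-⊛ zero    f n       = ⊛-zeroˡ f n
ones-⊛ (suc c) f zero    = cong (f 0 +_) (sym (Σ<-zero c (λ i _ → shiftedA-> f {j = suc i} z<s)))
ones-⊛ (suc c) f (suc n) = cong₂ _+_ (+-identityʳ (f (suc n)))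
  (trans (ones-⊛ c f n) (sym (Σ<-cong c (λ i _ → shiftedA-suc f n i))))

geometric : Series
geometric _ = 1

-- the number of admissible colours of a part of size k + 1
colours : ℕ → Series
colours c k = suc k ⊓ c

colours≗geometric⊛ones : ∀ c → colours c ≗ geometric ⊛ ones c
colours≗geometric⊛ones c k = trans (colours≗ones⊛geometric c k) (⊛-comm (ones c) geometric k)
  where
  colours≗ones⊛geometric : ∀ c → colours c ≗ ones c ⊛ geometric
  colours≗ones⊛geometric zero    k       = sym (⊛-zeroˡ geometric k)
  colours≗ones⊛geometric (suc c) zero    = refl
  colours≗ones⊛geometric (suc c) (suc k) = cong suc (colours≗ones⊛geometric c k)

colours-suc : ∀ c k → colours c (suc k) ≡ ones c (suc k) + colours c k
colours-suc c k = begin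
  colours c (suc k)                              ≡⟨ colours≗geometric⊛ones c (suc k) ⟩
  1 * ones c (suc k) + (geometric ⊛ ones c) k    ≡⟨ cong₂ _+_ (*-identityˡ _) (sym (colours≗geometric⊛ones c k)) ⟩
  ones c (suc k) + colours c k                   ∎

singlePart : ℕ → Series
singlePart c = X ⊛ colours c

singlePart^-coeff : ∀ c i n → (singlePart c ^ i) n ≡ shiftedA (colours c ^ i) n i
singlePart^-coeff c i n = begin
  (singlePart c ^ i) n        ≡⟨ ^-distrib-* X (colours c) i n ⟩
  (X ^ i ⊛ colours c ^ i) n   ≡⟨ X^-⊛ i (colours c ^ i) n ⟩
  shiftedA (colours c ^ i) n i ∎

-- The i-th summand counts the compositions with i parts; a composition of n has at most n.
count : ℕ → Series
count c n = Σ< (suc n) (λ i → (singlePart c ^ i) n)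

count-suc : ∀ c m → count c (suc m) ≡ (colours c ⊛ count c) m
count-suc c m = begin
  Σ< (suc m) (λ i → (singlePart c ^ suc i) (suc m))        ≡⟨ Σ<-cong (suc m) (λ i _ → peel i) ⟩
  Σ< (suc m) (λ i → (colours c ⊛ singlePart c ^ i) m)     ≡⟨ ⊛-Σ< (suc m) (colours c) (singlePart c ^_) m ⟨
  (colours c ⊛ (λ k → Σ< (suc m) (λ i → (singlePart c ^ i) k))) m
    ≡⟨ ⊛-cong-≤ m (λ _ _ → refl) (λ k k≤m → sym (truncate k k≤m)) ⟩
  (colours c ⊛ count c) m ∎
  where
  peel : ∀ i → (singlePart c ^ suc i) (suc m) ≡ (colours c ⊛ singlePart c ^ i) m
  peel i = trans (⊛-assoc X (colours c) (singlePart c ^ i) (suc m)) (X⊛-suc _ m)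
  truncate : ∀ k → k ≤ m → count c k ≡ Σ< (suc m) (λ i → (singlePart c ^ i) k)
  truncate k k≤m = begin
    count c k                                           ≡⟨ Σ<-extend (suc k) (m ∸ k) vanish ⟨
    Σ< (suc k + (m ∸ k)) (λ i → (singlePart c ^ i) k)   ≡⟨ cong (λ N → Σ< (suc N) (λ i → (singlePart c ^ i) k)) (m+[n∸m]≡n k≤m) ⟩
    Σ< (suc m) (λ i → (singlePart c ^ i) k)             ∎
    where
    vanish : ∀ i → suc k ≤ i → (singlePart c ^ i) k ≡ 0
    vanish i k<i = trans (singlePart^-coeff c i k) (shiftedA-> _ k<i)

count-one : ∀ c → 1 ≤ c → count c 1 ≡ 1
count-one (suc c) _ = refl

Colour : ℕ → ℕ → Set
Colour c k = Σ ℕ λ col → (1 ≤ col) × (col ≤ suc k) × (col ≤ c)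

Colour-≡ : ∀ {c k} (x y : Colour c k) → proj₁ x ≡ proj₁ y → x ≡ y
Colour-≡ (col , p , q , r) (col , p′ , q′ , r′) refl
  rewrite ≤-irrelevant p p′ | ≤-irrelevant q q′ | ≤-irrelevant r r′ = refl

Colour↔Fin : ∀ c k → Colour c k ↔ Fin (colours c k)
Colour↔Fin c k = mk↔ₛ′ to from to∘from from∘to
  where
  to : Colour c k → Fin (colours c k)
  to (suc j , _ , j<1+k , j<c) = fromℕ< (⊓-glb j<1+k j<c)
  from : Fin (colours c k) → Colour c k
  from i = suc (toℕ i) , s≤s z≤n , ≤-trans (toℕ<n i) (m⊓n≤m (suc k) c) , ≤-trans (toℕ<n i) (m⊓n≤n (suc k) c)
  to∘from : ∀ i → to (from i) ≡ i
  to∘from i = fromℕ<-toℕ i _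
  from∘to : ∀ col → from (to col) ≡ col
  from∘to col@(suc j , _ , j<1+k , j<c) = Colour-≡ (from (to col)) col (cong suc (toℕ-fromℕ< (⊓-glb j<1+k j<c)))

CauchyPair : (ℕ → Set) → (ℕ → Set) → ℕ → Set
CauchyPair F G m = Σ[ k ∈ ℕ ] k ≤ m × F k × G (m ∸ k)

CauchyPair↔Fin : ∀ {F G : ℕ → Set} {f g : Series} m → (∀ k → F k ↔ Fin (f k)) →
                 (∀ j → j ≤ m → G j ↔ Fin (g j)) → CauchyPair F G m ↔ Fin ((f ⊛ g) m)
CauchyPair↔Fin {F} {G} zero F↔f G↔g =
  ↔-trans split (↔-trans (F↔f 0 ×-↔ G↔g 0 z≤n) (↔-sym *↔×))
  where
  split : CauchyPair F G 0 ↔ (F 0 × G 0)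
  split = mk↔ₛ′ (λ { (zero , z≤n , x , y) → x , y }) (λ (x , y) → 0 , z≤n , x , y)
                (λ _ → refl) (λ { (zero , z≤n , x , y) → refl })
CauchyPair↔Fin {F} {G} (suc m) F↔f G↔g =
  ↔-trans split (↔-trans ((F↔f 0 ×-↔ G↔g (suc m) ≤-refl) ⊎-↔ CauchyPair↔Fin m (F↔f ∘ suc) (λ j j≤m → G↔g j (m≤n⇒m≤1+n j≤m)))
                         (↔-trans (↔-sym *↔× ⊎-↔ ↔-refl) (↔-sym +↔⊎)))
  where
  split : CauchyPair F G (suc m) ↔ ((F 0 × G (suc m)) ⊎ CauchyPair (F ∘ suc) G m)
  split = mk↔ₛ′ (λ { (zero , _ , x , y) → inj₁ (x , y) ; (suc k , s≤s k≤m , x , y) → inj₂ (k , k≤m , x , y) })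
                (λ { (inj₁ (x , y)) → 0 , z≤n , x , y ; (inj₂ (k , k≤m , x , y)) → suc k , s≤s k≤m , x , y })
                (λ { (inj₁ _) → refl ; (inj₂ _) → refl })
                (λ { (zero , z≤n , x , y) → refl ; (suc k , s≤s k≤m , x , y) → refl })

NCComp-zero↔⊤ : ∀ c → NCComp c 0 ↔ ⊤
NCComp-zero↔⊤ c = mk↔ₛ′ (λ _ → tt) (λ _ → [] , refl) (λ _ → refl) empty-unique
  where
  empty-unique : ∀ (x : NCComp c 0) → ([] , refl) ≡ x
  empty-unique ([] , e) = cong ([] ,_) (≡-irrelevant refl e)
  empty-unique ((zero , zero , () , _) ∷ ps , e)
  empty-unique ((zero , suc col , _ , () , _) ∷ ps , e)

NCComp-suc↔ : ∀ c m → NCComp c (suc m) ↔ CauchyPair (Colour c) (NCComp c) m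
NCComp-suc↔ c m = mk↔ₛ′ to from to∘from from∘to
  where
  total : List (Part c) → ℕ
  total ps = sum (map size ps)
  to : NCComp c (suc m) → CauchyPair (Colour c) (NCComp c) m
  to ((zero , zero , () , _) ∷ ps , e)
  to ((zero , suc col , _ , () , _) ∷ ps , e)
  to ((suc k , col) ∷ ps , e) =
    k , subst (k ≤_) k+ps≡m (m≤m+n k (total ps)) , col , ps , trans (sym (m+n∸m≡n k (total ps))) (cong (_∸ k) k+ps≡m)
    where
    k+ps≡m : k + total ps ≡ m
    k+ps≡m = suc-injective e
  from : CauchyPair (Colour c) (NCComp c) m → NCComp c (suc m)
  from (k , k≤m , col , ps , e) = (suc k , col) ∷ ps , cong suc (trans (cong (k +_) e) (m+[n∸m]≡n k≤m))
  to∘from : ∀ x → to (from x) ≡ x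
  to∘from (k , k≤m , col , ps , e) = cong₂ (λ p q → k , p , col , ps , q) (≤-irrelevant _ _) (≡-irrelevant _ _)
  from∘to : ∀ x → from (to x) ≡ x
  from∘to ((zero , zero , () , _) ∷ ps , e)
  from∘to ((zero , suc col , _ , () , _) ∷ ps , e)
  from∘to ((suc k , col) ∷ ps , e) = cong ((suc k , col) ∷ ps ,_) (≡-irrelevant _ _)

NCComp↔count : ∀ c n → NCComp c n ↔ Fin (count c n)
NCComp↔count c = <-rec (λ n → NCComp c n ↔ Fin (count c n)) step
  where
  step : ∀ n → (∀ {j} → j < n → NCComp c j ↔ Fin (count c j)) → NCComp c n ↔ Fin (count c n)
  step zero    _   = ↔-trans (NCComp-zero↔⊤ c) (↔-sym 1↔⊤)
  step (suc m) rec = subst (λ N → NCComp c (suc m) ↔ Fin N) (sym (count-suc c m))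
    (↔-trans (NCComp-suc↔ c m) (CauchyPair↔Fin m (Colour↔Fin c) (λ j j≤m → rec (s≤s j≤m))))

count-recurrence : ∀ c → 1 ≤ c → ∀ n → 2 ≤ n →
                   count c n ≡ 2 * count c (n ∸ 1) + ∑[ 2 ⋯ c ] (shiftedA (count c) n)
count-recurrence (suc c) _ (suc zero)    (s≤s ())
count-recurrence (suc c) _ (suc (suc n)) _ = begin
  count (suc c) (suc (suc n))
    ≡⟨ count-suc (suc c) (suc n) ⟩
  1 * a (suc n) + (colours (suc c) ∘ suc ⊛ a) n
    ≡⟨ cong₂ _+_ (*-identityˡ (a (suc n))) (⊛-cong (colours-suc (suc c)) (λ _ → refl) n) ⟩
  a (suc n) + ((ones c ⊕ colours (suc c)) ⊛ a) n
    ≡⟨ cong (a (suc n) +_) (⊛-distribʳ-⊕ a (ones c) (colours (suc c)) n) ⟩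
  a (suc n) + ((ones c ⊛ a) n + (colours (suc c) ⊛ a) n)
    ≡⟨ cong₂ (λ x y → a (suc n) + (x + y)) (ones-⊛ c a n) (sym (count-suc (suc c) n)) ⟩
  a (suc n) + (Σ< c (shiftedA a n) + a (suc n))
    ≡⟨ cong (a (suc n) +_) (+-comm _ (a (suc n))) ⟩
  a (suc n) + (a (suc n) + Σ< c (shiftedA a n))
    ≡⟨ +-assoc (a (suc n)) _ _ ⟨
  a (suc n) + a (suc n) + Σ< c (shiftedA a n)
    ≡⟨ cong (λ y → a (suc n) + y + Σ< c (shiftedA a n)) (+-identityʳ (a (suc n))) ⟨
  2 * a (suc n) + Σ< c (shiftedA a n)
    ≡⟨ cong (2 * a (suc n) +_) (Σ<-cong c (λ i _ → trans (shiftedA-suc a (suc n) (suc i)) (shiftedA-suc a n i))) ⟨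
  2 * a (suc n) + ∑[ 2 ⋯ suc c ] (shiftedA a (suc (suc n))) ∎
  where
  a : Series
  a = count (suc c)

sum-coeff : ∀ n (h : ℕ → Series) x → SeriesOps.sum {n} (λ i → h (toℕ i)) x ≡ Σ< n (λ i → h i x)
sum-coeff zero    h x = refl
sum-coeff (suc n) h x = cong (h 0 x +_) (sum-coeff n (h ∘ suc) x)

×-coeff : ∀ m f x → (m SeriesOps.× f) x ≡ m * f x
×-coeff zero    f x = refl
×-coeff (suc m) f x = cong (f x +_) (×-coeff m f x)

binomial-coeff : ∀ y f g x → ((f ⊕ g) ^ y) x ≡ Σ< (suc y) (λ k → (y C k) * (f ^ k ⊛ g ^ (y ∸ k)) x)
binomial-coeff y f g x = begin
  ((f ⊕ g) ^ y) x            ≡⟨ binomial-theorem y f g x ⟩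
  binomialExpansion f g y x  ≡⟨ sum-coeff (suc y) (λ k → (y C k) SeriesOps.× (f ^ k ⊛ g ^ (y ∸ k))) x ⟩
  Σ< (suc y) (λ k → ((y C k) SeriesOps.× (f ^ k ⊛ g ^ (y ∸ k))) x)
    ≡⟨ Σ<-cong (suc y) (λ k _ → ×-coeff (y C k) (f ^ k ⊛ g ^ (y ∸ k)) x) ⟩
  Σ< (suc y) (λ k → (y C k) * (f ^ k ⊛ g ^ (y ∸ k)) x) ∎

ones-suc : ∀ c → ones (suc c) ≗ ones c ⊕ X ^ c
ones-suc zero    k       = refl
ones-suc (suc c) zero    = refl
ones-suc (suc c) (suc k) = trans (ones-suc c k) (cong (ones c k +_) (sym (X⊛-suc (X ^ c) k)))

ones^-coeff : ∀ c y x → (ones (suc c) ^ y) x ≡ Σ< (suc y) (λ k → (y C k) * shiftedA (ones c ^ k) x (c * (y ∸ k)))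
ones^-coeff c y x = begin
  (ones (suc c) ^ y) x     ≡⟨ ^-congˡ y (ones-suc c) x ⟩
  ((ones c ⊕ X ^ c) ^ y) x ≡⟨ binomial-coeff y (ones c) (X ^ c) x ⟩
  Σ< (suc y) (λ k → (y C k) * (ones c ^ k ⊛ (X ^ c) ^ (y ∸ k)) x) ≡⟨ Σ<-cong (suc y) (λ k _ → cong ((y C k) *_) (term k)) ⟩
  Σ< (suc y) (λ k → (y C k) * shiftedA (ones c ^ k) x (c * (y ∸ k))) ∎
  where
  term : ∀ k → (ones c ^ k ⊛ (X ^ c) ^ (y ∸ k)) x ≡ shiftedA (ones c ^ k) x (c * (y ∸ k))
  term k = begin
    (ones c ^ k ⊛ (X ^ c) ^ (y ∸ k)) x  ≡⟨ ⊛-comm (ones c ^ k) _ x ⟩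
    ((X ^ c) ^ (y ∸ k) ⊛ ones c ^ k) x  ≡⟨ ⊛-cong (^-assocʳ X c (y ∸ k)) (λ _ → refl) x ⟩
    (X ^ (c * (y ∸ k)) ⊛ ones c ^ k) x  ≡⟨ X^-⊛ (c * (y ∸ k)) (ones c ^ k) x ⟩
    shiftedA (ones c ^ k) x (c * (y ∸ k)) ∎

geometric^-coeff : ∀ j ℓ → (geometric ^ suc j) ℓ ≡ (ℓ + j) C j
geometric^-coeff zero    ℓ       = ⊛-identityʳ geometric ℓ
geometric^-coeff (suc j) zero    = trans (+-identityʳ _) (trans (geometric^-coeff j 0) (trans (nCn≡1 j) (sym (nCn≡1 (suc j)))))
geometric^-coeff (suc j) (suc ℓ) = begin
  1 * (geometric ^ suc j) (suc ℓ) + (geometric ⊛ geometric ^ suc j) ℓ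
    ≡⟨ cong₂ _+_ (trans (*-identityˡ _) (geometric^-coeff j (suc ℓ))) (geometric^-coeff (suc j) ℓ) ⟩
  (suc ℓ + j) C j + (ℓ + suc j) C suc j
    ≡⟨ cong (λ n → n C j + (ℓ + suc j) C suc j) (+-suc ℓ j) ⟨
  (ℓ + suc j) C j + (ℓ + suc j) C suc j
    ≡⟨ nCk+nC[k+1]≡[n+1]C[k+1] (ℓ + suc j) j ⟩
  suc (ℓ + suc j) C suc j ∎

C-> : ∀ {n k} → n < k → n C k ≡ 0
C-> {n} {k} n<k with k ≤ᵇ n | ≤ᵇ⇒≤ k n
... | false | _   = refl
... | true  | k≤n = contradiction (k≤n _) (<⇒≱ n<k)

C≗ones2^ : ∀ y x → y C x ≡ (ones 2 ^ y) x
C≗ones2^ zero    zero    = refl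
C≗ones2^ zero    (suc x) = C-> {k = suc x} z<s
C≗ones2^ (suc y) zero    = sym (trans (+-identityʳ _) (sym (C≗ones2^ y zero)))
C≗ones2^ (suc y) (suc x) = begin
  suc y C suc x                          ≡⟨ nCk+nC[k+1]≡[n+1]C[k+1] y x ⟨
  y C x + y C suc x                      ≡⟨ +-comm (y C x) _ ⟩
  y C suc x + y C x                      ≡⟨ cong₂ _+_ (trans (C≗ones2^ y (suc x)) (sym (+-identityʳ _)))
                                                      (trans (C≗ones2^ y x) (sym (⊛-identityˡ (ones 2 ^ y) x))) ⟩
  (ones 2 ⊛ ones 2 ^ y) (suc x)           ∎

open import Data.Integer using (ℤ; +_; -[1+_]; -_) renaming (_-_ to _-ℤ_; _*_ to _*ℤ_)
open import Data.Integer.Properties using (pos-*; m-n≡m⊖n; ⊖-≥; ⊖-<)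

-[1+]-minus-+ : ∀ n r → ∃[ n′ ] -[1+ n ] -ℤ + r ≡ -[1+ n′ ]
-[1+]-minus-+ n zero    = n , refl
-[1+]-minus-+ n (suc r) = suc (n + r) , refl

Gaux-negative : ∀ m n y → Gaux m -[1+ n ] y ≡ 0
Gaux-negative zero    n y = refl
Gaux-negative (suc m) n y = Σ<-zero (suc y) (λ k _ → term k)
  where
  term : ∀ k → (y C (y ∸ k)) * Gaux m (-[1+ n ] -ℤ + suc (suc m) *ℤ + (y ∸ k)) k ≡ 0
  term k with -[1+]-minus-+ n (suc (suc m) * (y ∸ k))
  ... | n′ , eq rewrite sym (pos-* (suc (suc m)) (y ∸ k)) | eq | Gaux-negative m n′ k = *-zeroʳ (y C (y ∸ k))

shiftedA-minus : ∀ (h : ℤ → ℕ) → (∀ n → h -[1+ n ] ≡ 0) → ∀ x r → h (+ x -ℤ + r) ≡ shiftedA (h ∘ +_) x r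
shiftedA-minus h h-neg x r rewrite m-n≡m⊖n x r with r ≤? x
... | yes r≤x rewrite ⊖-≥ r≤x = sym (shiftedA-≤ (h ∘ +_) r≤x)
... | no  r≰x rewrite ⊖-< (≰⇒> r≰x) = trans (negative (r ∸ x) (m<n⇒0<n∸m (≰⇒> r≰x))) (sym (shiftedA-> (h ∘ +_) (≰⇒> r≰x)))
  where
  negative : ∀ t → 0 < t → h (- + t) ≡ 0
  negative (suc t) _ = h-neg t

Gaux≗ones^ : ∀ m y x → Gaux m (+ x) y ≡ (ones (2 + m) ^ y) x
Gaux≗ones^ zero    y x = C≗ones2^ y x
Gaux≗ones^ (suc m) y x = begin
  Σ< (suc y) (λ k → (y C (y ∸ k)) * Gaux m (+ x -ℤ + (2 + m) *ℤ + (y ∸ k)) k)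
    ≡⟨ Σ<-cong (suc y) (λ k k≤y → cong₂ _*_ (sym (nCk≡nC[n∸k] (s≤s⁻¹ k≤y))) (term k)) ⟩
  Σ< (suc y) (λ k → (y C k) * shiftedA (ones (2 + m) ^ k) x ((2 + m) * (y ∸ k)))
    ≡⟨ ones^-coeff (2 + m) y x ⟨
  (ones (3 + m) ^ y) x ∎
  where
  term : ∀ k → Gaux m (+ x -ℤ + (2 + m) *ℤ + (y ∸ k)) k ≡ shiftedA (ones (2 + m) ^ k) x ((2 + m) * (y ∸ k))
  term k = begin
    Gaux m (+ x -ℤ + (2 + m) *ℤ + (y ∸ k)) k          ≡⟨ cong (λ r → Gaux m (+ x -ℤ r) k) (pos-* (2 + m) (y ∸ k)) ⟨
    Gaux m (+ x -ℤ + ((2 + m) * (y ∸ k))) k           ≡⟨ shiftedA-minus (λ i → Gaux m i k) (λ n → Gaux-negative m n k) x ((2 + m) * (y ∸ k)) ⟩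
    shiftedA (λ x → Gaux m (+ x) k) x ((2 + m) * (y ∸ k)) ≡⟨ shiftedA-cong (Gaux≗ones^ m k) x ((2 + m) * (y ∸ k)) ⟩
    shiftedA (ones (2 + m) ^ k) x ((2 + m) * (y ∸ k)) ∎

count-formula : ∀ c → 2 ≤ c → ∀ n → 1 ≤ n →
                count c n ≡ ∑[ 1 ⋯ n ] (λ i → ∑[ 0 ⋯ n ∸ i ] (λ ℓ →
                              ((ℓ + i ∸ 1) C (i ∸ 1)) * G c (+ (n ∸ i ∸ ℓ)) i))
count-formula (suc zero)          (s≤s ()) _ _
count-formula c@(suc (suc c₂)) _        (suc m) _ = Σ<-cong (suc m) (λ i i<1+m → parts i (s≤s⁻¹ i<1+m))
  where
  parts : ∀ i → i ≤ m → (singlePart c ^ suc i) (suc m) ≡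
          Σ< (suc (m ∸ i)) (λ ℓ → ((ℓ + suc i ∸ 1) C i) * Gaux c₂ (+ (m ∸ i ∸ ℓ)) (suc i))
  parts i i≤m = begin
    (singlePart c ^ suc i) (suc m)                   ≡⟨ singlePart^-coeff c (suc i) (suc m) ⟩
    shiftedA (colours c ^ suc i) (suc m) (suc i)     ≡⟨ shiftedA-≤ (colours c ^ suc i) (s≤s i≤m) ⟩
    (colours c ^ suc i) (m ∸ i)                      ≡⟨ ^-congˡ (suc i) (colours≗geometric⊛ones c) (m ∸ i) ⟩
    ((geometric ⊛ ones c) ^ suc i) (m ∸ i)           ≡⟨ ^-distrib-* geometric (ones c) (suc i) (m ∸ i) ⟩
    (geometric ^ suc i ⊛ ones c ^ suc i) (m ∸ i)     ≡⟨ ⊛-coeff (geometric ^ suc i) (ones c ^ suc i) (m ∸ i) ⟩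
    Σ< (suc (m ∸ i)) (λ ℓ → (geometric ^ suc i) ℓ * (ones c ^ suc i) (m ∸ i ∸ ℓ))
      ≡⟨ Σ<-cong (suc (m ∸ i)) (λ ℓ _ → cong₂ _*_ (geometric-term ℓ) (sym (Gaux≗ones^ c₂ (suc i) (m ∸ i ∸ ℓ)))) ⟩
    Σ< (suc (m ∸ i)) (λ ℓ → ((ℓ + suc i ∸ 1) C i) * Gaux c₂ (+ (m ∸ i ∸ ℓ)) (suc i)) ∎
    where
    geometric-term : ∀ ℓ → (geometric ^ suc i) ℓ ≡ (ℓ + suc i ∸ 1) C i
    geometric-term ℓ = trans (geometric^-coeff i ℓ) (cong (λ n → (n ∸ 1) C i) (sym (+-suc ℓ i)))

proposition8 : (c : ℕ) → 1 ≤ c → (a : ℕ → ℕ) → (∀ n → NCComp c n ↔ Fin (a n)) →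
    (a 0 ≡ 1 × a 1 ≡ 1
      × (∀ n → 2 ≤ n → a n ≡ 2 * a (n ∸ 1) + ∑[ 2 ⋯ c ] (shiftedA a n)))
    × (2 ≤ c → ∀ n → 1 ≤ n →
        a n ≡ ∑[ 1 ⋯ n ] (λ i → ∑[ 0 ⋯ n ∸ i ] (λ ℓ →
                ((ℓ + i ∸ 1) C (i ∸ 1)) * G c (+ (n ∸ i ∸ ℓ)) i)))
proposition8 c 1≤c a NCComp↔a =
  (a≗count 0 , trans (a≗count 1) (count-one c 1≤c) , recurrence) ,
  λ 2≤c n 1≤n → trans (a≗count n) (count-formula c 2≤c n 1≤n)
  where
  a≗count : a ≗ count c
  a≗count n = ↔⇒≡ (↔-trans (↔-sym (NCComp↔a n)) (NCComp↔count c n))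

  recurrence : ∀ n → 2 ≤ n → a n ≡ 2 * a (n ∸ 1) + ∑[ 2 ⋯ c ] (shiftedA a n)
  recurrence n 2≤n = begin
    a n                                                           ≡⟨ a≗count n ⟩
    count c n                                                     ≡⟨ count-recurrence c 1≤c n 2≤n ⟩
    2 * count c (n ∸ 1) + ∑[ 2 ⋯ c ] (shiftedA (count c) n)
      ≡⟨ cong₂ (λ x s → 2 * x + s) (a≗count (n ∸ 1)) (Σ<-cong (suc c ∸ 2) (λ i _ → shiftedA-cong a≗count n (2 + i))) ⟨
    2 * a (n ∸ 1) + ∑[ 2 ⋯ c ] (shiftedA a n)                     ∎
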